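{- Let $G=(V,E)$ be an undirected graph and $s,a,b\in V$ with $a,b\ne s$. Let $A$ be an $sa$-tight set and $B$ an $sb$-tight set, where $\kappa(s,a)\ge\kappa(s,b)$. Then exactly one of the following holds. (ia) $a\in A^*\cap B^*$, $\kappa(s,a)=\kappa(s,b)$, the sets $A\cap B$ and $A\cup B$ are both $sa$-tight, and $A\cap B$ is $sb$-tight. (ib) $a\notin A^*\cap B^*$, $b\in A^*\cap B^*$, $A\cap B$ is $sa$-tight, and $A\cup B$ is $sb$-tight. (ii) $a\in A^*\cap B$, $b\in B^*\cap A$, $A^*\cap B$ is $as$-tight, and $B^*\cap A$ is $bs$-tight. (iii) $a\in\partial B$ and $b\in B^*\cap A$; or $b\in\partial A$ and $a\in A^*\cap B$; or $a\in\partial B$ and $b\in\partial A$.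
   Context: $\kappa(x,y)$ is the maximum number of internally disjoint $xy$-paths in $G$. For $A\subseteq V$, $\partial A$ is the set of nodes outside $A$ having a neighbor in $A$, and $A^*=V\setminus(A\cup\partial A)$. $A$ is an $xy$-set if $x\in A$ and $y\in A^*$; $A$ is $xy$-tight if $A$ is an $xy$-set and $|\partial A|=\kappa(x,y)$. -}

module Defs where

open import Data.Nat using (ℕ; zero; suc; _≤_)
open import Data.Bool using (Bool; true; false; _∧_; _∨_; not)
open import Data.Fin using (Fin; zero; suc)
open import Data.Fin.Subset using (Subset; _∈_; _∉_; _∩_; _∪_; ∁; ∣_∣)
open import Data.Vec using (lookup; tabulate)
open import Data.List using (List; []; _∷_; _++_)
import Data.List.Membership.Propositional as LM
open import Data.List.Relation.Unary.Unique.Propositional using (Unique)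
open import Data.Product using (Σ; _×_)
open import Data.Sum using (_⊎_)
open import Data.Empty using (⊥)
open import Relation.Nullary using (¬_)
open import Relation.Binary.PropositionalEquality using (_≡_; _≢_)

record Graph (n : ℕ) : Set where
  field
    adj    : Fin n → Fin n → Bool
    sym    : ∀ u v → adj u v ≡ adj v u
    irrefl : ∀ v → adj v v ≡ false
open Graph public

module _ {n : ℕ} (G : Graph n) where

  data Walk : Fin n → Fin n → Set where
    nil  : ∀ {x} → Walk x x
    cons : ∀ {x z y} → adj G x z ≡ true → Walk z y → Walk x y

  initVerts : ∀ {x y} → Walk x y → List (Fin n)
  initVerts nil = []
  initVerts (cons {x} _ w) = x ∷ initVerts w

  verts : ∀ {x y} → Walk x y → List (Fin n)
  verts {y = y} w = initVerts w ++ (y ∷ [])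

  interior : ∀ {x y} → Walk x y → List (Fin n)
  interior nil = []
  interior (cons _ w) = initVerts w

  record Path (x y : Fin n) : Set where
    field
      walk   : Walk x y
      simple : Unique (verts walk)
  open Path public

  DisjointL : List (Fin n) → List (Fin n) → Set
  DisjointL l₁ l₂ = ∀ v → v LM.∈ l₁ → v LM.∈ l₂ → ⊥

  HasDisjointPaths : Fin n → Fin n → ℕ → Set
  HasDisjointPaths x y k =
    Σ (Fin k → Path x y) λ P → ∀ i j → i ≢ j →
      DisjointL (interior (walk (P i))) (interior (walk (P j)))
      × verts (walk (P i)) ≢ verts (walk (P j))

  IsKappa : Fin n → Fin n → ℕ → Set
  IsKappa x y k = HasDisjointPaths x y k × (∀ m → HasDisjointPaths x y m → m ≤ k)

  anyᵇ : ∀ {m} → (Fin m → Bool) → Bool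
  anyᵇ {zero} f = false
  anyᵇ {suc m} f = f zero ∨ anyᵇ (λ i → f (suc i))

  ∂ : Subset n → Subset n
  ∂ A = tabulate λ v → not (lookup A v) ∧ anyᵇ (λ u → adj G v u ∧ lookup A u)

  _* : Subset n → Subset n
  A * = ∁ (A ∪ ∂ A)

  IsXYSet : Fin n → Fin n → Subset n → Set
  IsXYSet x y A = x ∈ A × y ∈ A *

  Tight : Fin n → Fin n → Subset n → Set
  Tight x y A = IsXYSet x y A × IsKappa x y ∣ ∂ A ∣

ExactlyOne4 : Set → Set → Set → Set → Set
ExactlyOne4 P Q R S =
  (P ⊎ Q ⊎ R ⊎ S)
  × ¬ (P × Q) × ¬ (P × R) × ¬ (P × S)
  × ¬ (Q × R) × ¬ (Q × S) × ¬ (R × S)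

-- The vertex boundary is submodular, ∣∂(A∩B)∣ + ∣∂(A∪B)∣ ≤ ∣∂A∣ + ∣∂B∣, and posimodular,
-- ∣∂(A*∩B)∣ + ∣∂(B*∩A)∣ ≤ ∣∂A∣ + ∣∂B∣: for both pairs X, Y of new sets one has
-- ∂X ∩ ∂Y ⊆ ∂A ∩ ∂B and ∂X ∪ ∂Y ⊆ ∂A ∪ ∂B. By the easy half of Menger's theorem every
-- xy-set X has ∣∂X∣ ≥ κ(x,y), because every xy-path has an interior vertex in ∂X. So whenever
-- the two new sets are xy-sets for suitable pairs, their boundaries sum to at most
-- κ(s,a) + κ(s,b) while each is at least its own κ, and both are tight. Which pairs are
-- suitable is decided by whether a lies in B, ∂B or B*, and b in A, ∂A or A*.
module Submission where

open import Defs hiding (sym)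
open import Data.Nat using (ℕ; zero; suc; _+_; _≤_; z≤n)
open import Data.Nat.Properties
  using (≤-refl; ≤-reflexive; ≤-trans; ≤-<-trans; ≤-antisym; +-mono-≤; +-suc; +-cancelˡ-≤; +-cancelʳ-≤; module ≤-Reasoning)
open import Data.Bool using (Bool; true; false; _∧_; _∨_; not)
open import Data.Bool.Properties using (∧-conicalˡ; ∧-conicalʳ; ∨-zeroʳ)
open import Data.Fin using (Fin; zero; suc; _≟_)
open import Data.Fin.Properties using (0≢1+n; suc-injective)
open import Data.Fin.Subset using (Subset; _∈_; _∉_; _⊆_; _∩_; _∪_; ∁; _-_; ∣_∣)
open import Data.Fin.Subset.Properties
  using (_∈?_; x∈p∩q⁺; x∈p∩q⁻; x∈p∪q⁺; x∈p∪q⁻; p∩q⊆p; p∩q⊆q; x∈∁p⇒x∉p; x∉p⇒x∈∁p;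
         p⊆q⇒∣p∣≤∣q∣; x∈p∧x≢y⇒x∈p-y; x∈p⇒∣p-x∣<∣p∣)
open import Data.Vec using ([]; _∷_; lookup; tabulate)
open import Data.Vec.Properties using ([]=⇒lookup; lookup⇒[]=; lookup∘tabulate; lookup-map; lookup-zipWith)
open import Data.List using ([]; _∷_; _++_; reverse)
open import Data.List.Properties using (∷-injectiveʳ; ++-cancelʳ; unfold-reverse; reverse-++; reverse-injective)
open import Data.List.Membership.Propositional using () renaming (_∈_ to _∈ₗ_)
open import Data.List.Relation.Unary.Any using (here; there)
open import Data.List.Relation.Unary.Any.Properties using (reverse⁻)
open import Data.List.Relation.Unary.Unique.Propositional using (Unique)
open import Data.List.Relation.Binary.Permutation.Setoid using (↭-sym)
open import Data.List.Relation.Binary.Permutation.Setoid.Properties using (Unique-resp-↭; ↭-reverse)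
open import Data.Product using (∃; _×_; _,_; proj₁; proj₂)
open import Data.Sum using (_⊎_; inj₁; inj₂; [_,_])
import Data.Sum as Sum
open import Data.Empty using (⊥-elim)
open import Function using (_∘_; Injective)
open import Relation.Nullary using (¬_; yes; no)
open import Relation.Binary.PropositionalEquality
  using (_≡_; _≢_; refl; sym; trans; cong; cong₂; subst; setoid; module ≡-Reasoning)

∣p∪q∣+∣p∩q∣≡∣p∣+∣q∣ : ∀ {n} (p q : Subset n) → ∣ p ∪ q ∣ + ∣ p ∩ q ∣ ≡ ∣ p ∣ + ∣ q ∣
∣p∪q∣+∣p∩q∣≡∣p∣+∣q∣ [] [] = refl
∣p∪q∣+∣p∩q∣≡∣p∣+∣q∣ (true ∷ p) (true ∷ q)
  rewrite +-suc ∣ p ∪ q ∣ ∣ p ∩ q ∣ | +-suc ∣ p ∣ ∣ q ∣ = cong (2 +_) (∣p∪q∣+∣p∩q∣≡∣p∣+∣q∣ p q)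
∣p∪q∣+∣p∩q∣≡∣p∣+∣q∣ (true ∷ p) (false ∷ q) = cong (1 +_) (∣p∪q∣+∣p∩q∣≡∣p∣+∣q∣ p q)
∣p∪q∣+∣p∩q∣≡∣p∣+∣q∣ (false ∷ p) (true ∷ q)
  rewrite +-suc ∣ p ∣ ∣ q ∣ = cong (1 +_) (∣p∪q∣+∣p∩q∣≡∣p∣+∣q∣ p q)
∣p∪q∣+∣p∩q∣≡∣p∣+∣q∣ (false ∷ p) (false ∷ q) = ∣p∪q∣+∣p∩q∣≡∣p∣+∣q∣ p q

∩⊆∩∧∪⊆∪⇒∣p∣+∣q∣≤∣r∣+∣s∣ : ∀ {n} {p q r s : Subset n} →
  p ∩ q ⊆ r ∩ s → p ∪ q ⊆ r ∪ s → ∣ p ∣ + ∣ q ∣ ≤ ∣ r ∣ + ∣ s ∣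
∩⊆∩∧∪⊆∪⇒∣p∣+∣q∣≤∣r∣+∣s∣ {p = p} {q} {r} {s} ∩⊆ ∪⊆ = begin
  ∣ p ∣ + ∣ q ∣          ≡⟨ sym (∣p∪q∣+∣p∩q∣≡∣p∣+∣q∣ p q) ⟩
  ∣ p ∪ q ∣ + ∣ p ∩ q ∣  ≤⟨ +-mono-≤ (p⊆q⇒∣p∣≤∣q∣ ∪⊆) (p⊆q⇒∣p∣≤∣q∣ ∩⊆) ⟩
  ∣ r ∪ s ∣ + ∣ r ∩ s ∣  ≡⟨ ∣p∪q∣+∣p∩q∣≡∣p∣+∣q∣ r s ⟩
  ∣ r ∣ + ∣ s ∣          ∎
  where open ≤-Reasoning

injective⇒≤∣p∣ : ∀ {n k} (p : Subset n) (f : Fin k → Fin n) →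
  (∀ i → f i ∈ p) → Injective _≡_ _≡_ f → k ≤ ∣ p ∣
injective⇒≤∣p∣ {k = zero}  p f f∈p f-inj = z≤n
injective⇒≤∣p∣ {k = suc k} p f f∈p f-inj =
  ≤-<-trans (injective⇒≤∣p∣ (p - f zero) (f ∘ suc) f∘suc∈p-f0 (suc-injective ∘ f-inj))
            (x∈p⇒∣p-x∣<∣p∣ (f∈p zero))
  where
  f∘suc∈p-f0 : ∀ i → f (suc i) ∈ p - f zero
  f∘suc∈p-f0 i = x∈p∧x≢y⇒x∈p-y (f∈p (suc i)) (λ e → 0≢1+n (sym (f-inj e)))

+-squeeze : ∀ {k l x y} → k ≤ x → l ≤ y → x + y ≤ k + l → x ≡ k × y ≡ l
+-squeeze {k} {l} {x} {y} k≤x l≤y x+y≤k+l =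
  ≤-antisym (+-cancelʳ-≤ y x k (≤-trans x+y≤k+l (+-mono-≤ (≤-refl {k}) l≤y))) k≤x ,
  ≤-antisym (+-cancelˡ-≤ x y l (≤-trans x+y≤k+l (+-mono-≤ k≤x (≤-refl {l})))) l≤y

∪-least : ∀ {n} {p q r : Subset n} → p ⊆ r → q ⊆ r → p ∪ q ⊆ r
∪-least {p = p} {q} p⊆r q⊆r = [ p⊆r , q⊆r ] ∘ x∈p∪q⁻ p q

anyᵇ⁺ : ∀ {n m} (G : Graph n) (f : Fin m → Bool) i → f i ≡ true → anyᵇ G f ≡ true
anyᵇ⁺ G f zero    fi≡true rewrite fi≡true = refl
anyᵇ⁺ G f (suc i) fi≡true = trans (cong (f zero ∨_) (anyᵇ⁺ G (f ∘ suc) i fi≡true)) (∨-zeroʳ (f zero))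


anyᵇ⁻ : ∀ {n m} (G : Graph n) (f : Fin m → Bool) → anyᵇ G f ≡ true → ∃ λ i → f i ≡ true
anyᵇ⁻ {m = suc m} G f any≡true with f zero in f0≡
... | true  = zero , f0≡
... | false with anyᵇ⁻ G (f ∘ suc) any≡true
...   | i , fi≡true = suc i , fi≡true

∈-lookup-cong : ∀ {n} {p q : Subset n} {v} → lookup p v ≡ lookup q v → v ∈ p → v ∈ q
∈-lookup-cong {q = q} {v} eq v∈p = lookup⇒[]= v q (trans (sym eq) ([]=⇒lookup v∈p))

module _ {n : ℕ} (G : Graph n) where

  _∼_ : Fin n → Fin n → Set
  u ∼ v = adj G u v ≡ true

  ∼-sym : ∀ {u v} → u ∼ v → v ∼ u
  ∼-sym {u} {v} u∼v = trans (Graph.sym G v u) u∼v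

  nbhd : Subset n → Subset n
  nbhd A = tabulate λ v → anyᵇ G λ u → adj G v u ∧ lookup A u

  ∈nbhd⁺ : ∀ {A v u} → v ∼ u → u ∈ A → v ∈ nbhd A
  ∈nbhd⁺ {A} {v} {u} v∼u u∈A = lookup⇒[]= v (nbhd A)
    (trans (lookup∘tabulate _ v) (anyᵇ⁺ G _ u (cong₂ _∧_ v∼u ([]=⇒lookup u∈A))))

  ∈nbhd⁻ : ∀ {A v} → v ∈ nbhd A → ∃ λ u → v ∼ u × u ∈ A
  ∈nbhd⁻ {A} {v} v∈N
    with u , uv≡true ← anyᵇ⁻ G _ (trans (sym (lookup∘tabulate _ v)) ([]=⇒lookup v∈N))
    = u , ∧-conicalˡ _ _ uv≡true , lookup⇒[]= u A (∧-conicalʳ _ _ uv≡true)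

  nbhd-mono : ∀ {A B} → A ⊆ B → nbhd A ⊆ nbhd B
  nbhd-mono A⊆B v∈N with u , v∼u , u∈A ← ∈nbhd⁻ v∈N = ∈nbhd⁺ v∼u (A⊆B u∈A)

  nbhd-∪ : ∀ {A B} → nbhd (A ∪ B) ⊆ nbhd A ∪ nbhd B
  nbhd-∪ {A} {B} v∈N with u , v∼u , u∈A∪B ← ∈nbhd⁻ v∈N =
    x∈p∪q⁺ (Sum.map (∈nbhd⁺ v∼u) (∈nbhd⁺ v∼u) (x∈p∪q⁻ A B u∈A∪B))

  ∂≗∁∩nbhd : ∀ A v → lookup (∂ G A) v ≡ lookup (∁ A ∩ nbhd A) v
  ∂≗∁∩nbhd A v = begin
    lookup (∂ G A) v                         ≡⟨ lookup∘tabulate _ v ⟩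
    not (lookup A v) ∧ anyᵇ G (λ u → adj G v u ∧ lookup A u)
                                             ≡⟨ cong₂ _∧_ (sym (lookup-map v not A)) (sym (lookup∘tabulate _ v)) ⟩
    lookup (∁ A) v ∧ lookup (nbhd A) v       ≡⟨ sym (lookup-zipWith _∧_ v (∁ A) (nbhd A)) ⟩
    lookup (∁ A ∩ nbhd A) v                  ∎
    where open ≡-Reasoning

  ∈∂⁺ : ∀ {A v} → v ∉ A → v ∈ nbhd A → v ∈ ∂ G A
  ∈∂⁺ {A} {v} v∉A v∈N = ∈-lookup-cong (sym (∂≗∁∩nbhd A v)) (x∈p∩q⁺ (x∉p⇒x∈∁p v∉A , v∈N))

  ∈∂⁻ : ∀ {A v} → v ∈ ∂ G A → v ∉ A × v ∈ nbhd A
  ∈∂⁻ {A} {v} v∈∂A with v∈∁A , v∈N ← x∈p∩q⁻ (∁ A) (nbhd A) (∈-lookup-cong (∂≗∁∩nbhd A v) v∈∂A) =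
    x∈∁p⇒x∉p v∈∁A , v∈N

  ∈*⁺ : ∀ {A v} → v ∉ A → v ∉ nbhd A → v ∈ _* G A
  ∈*⁺ {A} v∉A v∉N = x∉p⇒x∈∁p λ v∈A∪∂A → [ v∉A , v∉N ∘ proj₂ ∘ ∈∂⁻ {A} ] (x∈p∪q⁻ A (∂ G A) v∈A∪∂A)

  ∈*⁻ : ∀ {A v} → v ∈ _* G A → v ∉ A × v ∉ nbhd A
  ∈*⁻ {A} v∈A* = v∉A , λ v∈N → v∉A∪∂A (x∈p∪q⁺ (inj₂ (∈∂⁺ {A} v∉A v∈N)))
    where
    v∉A∪∂A : _ ∉ A ∪ ∂ G A
    v∉A∪∂A = x∈∁p⇒x∉p v∈A*
    v∉A : _ ∉ A
    v∉A = v∉A∪∂A ∘ x∈p∪q⁺ ∘ inj₁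

  ∈⊎∈∂⊎∈* : ∀ A v → v ∈ A ⊎ v ∈ ∂ G A ⊎ v ∈ _* G A
  ∈⊎∈∂⊎∈* A v with v ∈? A | v ∈? nbhd A
  ... | yes v∈A | _        = inj₁ v∈A
  ... | no v∉A  | yes v∈N  = inj₂ (inj₁ (∈∂⁺ v∉A v∈N))
  ... | no v∉A  | no v∉N   = inj₂ (inj₂ (∈*⁺ v∉A v∉N))

  ∈*⇒∉ : ∀ {A v} → v ∈ _* G A → v ∉ A
  ∈*⇒∉ {A} = proj₁ ∘ ∈*⁻ {A}

  ∈∂⇒∉ : ∀ {A v} → v ∈ ∂ G A → v ∉ A
  ∈∂⇒∉ {A} = proj₁ ∘ ∈∂⁻ {A}

  ∈∂⇒∉* : ∀ {A v} → v ∈ ∂ G A → v ∉ _* G A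
  ∈∂⇒∉* {A} v∈∂A v∈A* = proj₂ (∈*⁻ {A} v∈A*) (proj₂ (∈∂⁻ {A} v∈∂A))

  nbhd[*]⇒∉ : ∀ {A v} → v ∈ nbhd (_* G A) → v ∉ A
  nbhd[*]⇒∉ {A} v∈N v∈A with u , v∼u , u∈A* ← ∈nbhd⁻ v∈N = proj₂ (∈*⁻ {A} u∈A*) (∈nbhd⁺ (∼-sym v∼u) v∈A)

  p⊆q⇒q*⊆p* : ∀ {A B} → A ⊆ B → _* G B ⊆ _* G A
  p⊆q⇒q*⊆p* {A} {B} A⊆B v∈B* with v∉B , v∉NB ← ∈*⁻ {B} v∈B* = ∈*⁺ {A} (v∉B ∘ A⊆B) (v∉NB ∘ nbhd-mono A⊆B)

  p*∩q*⊆[p∪q]* : ∀ {A B} → _* G A ∩ _* G B ⊆ _* G (A ∪ B)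
  p*∩q*⊆[p∪q]* {A} {B} v∈A*∩B*
    with v∈A* , v∈B* ← x∈p∩q⁻ (_* G A) (_* G B) v∈A*∩B* =
    ∈*⁺ (λ v∈A∪B → [ ∈*⇒∉ {A} v∈A* , ∈*⇒∉ {B} v∈B* ] (x∈p∪q⁻ A B v∈A∪B))
        (λ v∈N → [ proj₂ (∈*⁻ {A} v∈A*) , proj₂ (∈*⁻ {B} v∈B*) ] (x∈p∪q⁻ (nbhd A) (nbhd B) (nbhd-∪ {A} {B} v∈N)))

  p⊆[p*∩q]* : ∀ {A B} → A ⊆ _* G (_* G A ∩ B)
  p⊆[p*∩q]* {A} {B} v∈A = ∈*⁺ (λ v∈A*∩B → ∈*⇒∉ {A} (proj₁ (x∈p∩q⁻ (_* G A) B v∈A*∩B)) v∈A)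
                              (λ v∈N → nbhd[*]⇒∉ {A} (nbhd-mono (p∩q⊆p (_* G A) B) v∈N) v∈A)

  ∂[p∩q]⊆∂p∪∂q : ∀ {A B} → ∂ G (A ∩ B) ⊆ ∂ G A ∪ ∂ G B
  ∂[p∩q]⊆∂p∪∂q {A} {B} {v} v∈∂ with ∈∂⁻ {A ∩ B} v∈∂ | v ∈? A
  ... | v∉A∩B , v∈N | yes v∈A =
    x∈p∪q⁺ (inj₂ (∈∂⁺ (λ v∈B → v∉A∩B (x∈p∩q⁺ (v∈A , v∈B))) (nbhd-mono (p∩q⊆q A B) v∈N)))
  ... | _     , v∈N | no v∉A  = x∈p∪q⁺ (inj₁ (∈∂⁺ v∉A (nbhd-mono (p∩q⊆p A B) v∈N)))

  ∂[p∪q]⊆∂p∪∂q : ∀ {A B} → ∂ G (A ∪ B) ⊆ ∂ G A ∪ ∂ G B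
  ∂[p∪q]⊆∂p∪∂q {A} {B} v∈∂ with v∉A∪B , v∈N ← ∈∂⁻ {A ∪ B} v∈∂ =
    x∈p∪q⁺ (Sum.map (∈∂⁺ (v∉A∪B ∘ x∈p∪q⁺ ∘ inj₁)) (∈∂⁺ (v∉A∪B ∘ x∈p∪q⁺ ∘ inj₂))
                    (x∈p∪q⁻ (nbhd A) (nbhd B) (nbhd-∪ {A} {B} v∈N)))

  ∂[p∩q]∩∂[p∪q]⊆∂p∩∂q : ∀ {A B} → ∂ G (A ∩ B) ∩ ∂ G (A ∪ B) ⊆ ∂ G A ∩ ∂ G B
  ∂[p∩q]∩∂[p∪q]⊆∂p∩∂q {A} {B} v∈∂∩∂ with v∈∂∩ , v∈∂∪ ← x∈p∩q⁻ (∂ G (A ∩ B)) (∂ G (A ∪ B)) v∈∂∩∂ =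
    x∈p∩q⁺ (∈∂⁺ (v∉A∪B ∘ x∈p∪q⁺ ∘ inj₁) (nbhd-mono (p∩q⊆p A B) v∈N) ,
            ∈∂⁺ (v∉A∪B ∘ x∈p∪q⁺ ∘ inj₂) (nbhd-mono (p∩q⊆q A B) v∈N))
    where
    v∉A∪B : _ ∉ A ∪ B
    v∉A∪B = ∈∂⇒∉ {A ∪ B} v∈∂∪
    v∈N : _ ∈ nbhd (A ∩ B)
    v∈N = proj₂ (∈∂⁻ {A ∩ B} v∈∂∩)

  ∈∂[p*∩q]⁻ : ∀ {A B v} → v ∈ ∂ G (_* G A ∩ B) → v ∉ A × v ∈ nbhd B
  ∈∂[p*∩q]⁻ {A} {B} v∈∂ with v∈N ← proj₂ (∈∂⁻ {_* G A ∩ B} v∈∂) =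
    nbhd[*]⇒∉ {A} (nbhd-mono (p∩q⊆p (_* G A) B) v∈N) , nbhd-mono (p∩q⊆q (_* G A) B) v∈N

  ∂[p*∩q]⊆∂p∪∂q : ∀ {A B} → ∂ G (_* G A ∩ B) ⊆ ∂ G A ∪ ∂ G B
  ∂[p*∩q]⊆∂p∪∂q {A} {B} {v} v∈∂ with ∈∂[p*∩q]⁻ {A} v∈∂ | v ∈? B | v ∈? nbhd A
  ... | _       , v∈NB | no v∉B  | _        = x∈p∪q⁺ (inj₂ (∈∂⁺ v∉B v∈NB))
  ... | v∉A     , _    | yes _   | yes v∈NA = x∈p∪q⁺ (inj₁ (∈∂⁺ v∉A v∈NA))
  ... | v∉A     , _    | yes v∈B | no v∉NA  =
    ⊥-elim (∈∂⇒∉ {_* G A ∩ B} v∈∂ (x∈p∩q⁺ (∈*⁺ v∉A v∉NA , v∈B)))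

  ∂[p*∩q]∩∂[q*∩p]⊆∂p∩∂q : ∀ {A B} → ∂ G (_* G A ∩ B) ∩ ∂ G (_* G B ∩ A) ⊆ ∂ G A ∩ ∂ G B
  ∂[p*∩q]∩∂[q*∩p]⊆∂p∩∂q {A} {B} v∈∂∩∂
    with v∈∂₁ , v∈∂₂ ← x∈p∩q⁻ (∂ G (_* G A ∩ B)) (∂ G (_* G B ∩ A)) v∈∂∩∂
    with v∉A , v∈NB ← ∈∂[p*∩q]⁻ {A} v∈∂₁ | v∉B , v∈NA ← ∈∂[p*∩q]⁻ {B} v∈∂₂
    = x∈p∩q⁺ (∈∂⁺ v∉A v∈NA , ∈∂⁺ v∉B v∈NB)

  ∂-submodular : ∀ A B → ∣ ∂ G (A ∩ B) ∣ + ∣ ∂ G (A ∪ B) ∣ ≤ ∣ ∂ G A ∣ + ∣ ∂ G B ∣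
  ∂-submodular A B = ∩⊆∩∧∪⊆∪⇒∣p∣+∣q∣≤∣r∣+∣s∣ (∂[p∩q]∩∂[p∪q]⊆∂p∩∂q {A} {B})
    (∪-least (∂[p∩q]⊆∂p∪∂q {A} {B}) (∂[p∪q]⊆∂p∪∂q {A} {B}))

  ∂-posimodular : ∀ A B → ∣ ∂ G (_* G A ∩ B) ∣ + ∣ ∂ G (_* G B ∩ A) ∣ ≤ ∣ ∂ G A ∣ + ∣ ∂ G B ∣
  ∂-posimodular A B = ∩⊆∩∧∪⊆∪⇒∣p∣+∣q∣≤∣r∣+∣s∣ (∂[p*∩q]∩∂[q*∩p]⊆∂p∩∂q {A} {B})
    (∪-least (∂[p*∩q]⊆∂p∪∂q {A} {B}) (∪-comm-⊆ ∘ ∂[p*∩q]⊆∂p∪∂q {B} {A}))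
    where
    ∪-comm-⊆ : ∂ G B ∪ ∂ G A ⊆ ∂ G A ∪ ∂ G B
    ∪-comm-⊆ = x∈p∪q⁺ ∘ Sum.swap ∘ x∈p∪q⁻ (∂ G B) (∂ G A)

  interior⊆initVerts : ∀ {x y v} (w : Walk G x y) → v ∈ₗ interior G w → v ∈ₗ initVerts G w
  interior⊆initVerts (cons _ _) = there

  walk-meets-∂ : ∀ {X x y} → x ∈ X → y ∈ _* G X → (w : Walk G x y) →
    ∃ λ v → v ∈ₗ interior G w × v ∈ ∂ G X
  walk-meets-∂ {X} x∈X y∈X* nil = ⊥-elim (∈*⇒∉ {X} y∈X* x∈X)
  walk-meets-∂ {X} x∈X y∈X* (cons {z = z} x∼z w) with z ∈? X
  ... | yes z∈X with v , v∈I , v∈∂X ← walk-meets-∂ z∈X y∈X* w = v , interior⊆initVerts w v∈I , v∈∂X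
  ... | no z∉X = z , first∈initVerts y∈X* w , z∈∂X
    where
    z∈∂X : z ∈ ∂ G X
    z∈∂X = ∈∂⁺ z∉X (∈nbhd⁺ (∼-sym x∼z) x∈X)
    first∈initVerts : ∀ {y} → y ∈ _* G X → (w : Walk G z y) → z ∈ₗ initVerts G w
    first∈initVerts z∈X* nil        = ⊥-elim (∈∂⇒∉* {X} z∈∂X z∈X*)
    first∈initVerts _    (cons _ _) = here refl

  disjointPaths≤∣∂∣ : ∀ {X x y k} → x ∈ X → y ∈ _* G X → HasDisjointPaths G x y k → k ≤ ∣ ∂ G X ∣
  disjointPaths≤∣∂∣ {X} x∈X y∈X* (P , disjoint) =
    injective⇒≤∣p∣ (∂ G X) (proj₁ ∘ meet) (proj₂ ∘ proj₂ ∘ meet) meet-injective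
    where
    meet : ∀ i → ∃ λ v → v ∈ₗ interior G (walk (P i)) × v ∈ ∂ G X
    meet i = walk-meets-∂ x∈X y∈X* (walk (P i))
    meet-injective : Injective _≡_ _≡_ (proj₁ ∘ meet)
    meet-injective {i} {j} eq with i ≟ j
    ... | yes i≡j = i≡j
    ... | no i≢j  = ⊥-elim (proj₁ (disjoint i j i≢j) _ (proj₁ (proj₂ (meet i)))
                      (subst (_∈ₗ interior G (walk (P j))) (sym eq) (proj₁ (proj₂ (meet j)))))

  IsKappa⇒≤∣∂∣ : ∀ {X x y k} → IsXYSet G x y X → IsKappa G x y k → k ≤ ∣ ∂ G X ∣
  IsKappa⇒≤∣∂∣ (x∈X , y∈X*) (paths , _) = disjointPaths≤∣∂∣ x∈X y∈X* paths

  IsKappa-unique : ∀ {x y k l} → IsKappa G x y k → IsKappa G x y l → k ≡ l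
  IsKappa-unique (pathsₖ , maxₖ) (pathsₗ , maxₗ) = ≤-antisym (maxₗ _ pathsₖ) (maxₖ _ pathsₗ)

  _++ʷ_ : ∀ {x y z} → Walk G x y → Walk G y z → Walk G x z
  nil      ++ʷ w′ = w′
  cons e w ++ʷ w′ = cons e (w ++ʷ w′)

  initVerts-++ʷ : ∀ {x y z} (w : Walk G x y) (w′ : Walk G y z) →
    initVerts G (w ++ʷ w′) ≡ initVerts G w ++ initVerts G w′
  initVerts-++ʷ nil        w′ = refl
  initVerts-++ʷ (cons e w) w′ = cong (_ ∷_) (initVerts-++ʷ w w′)

  reverseʷ : ∀ {x y} → Walk G x y → Walk G y x
  reverseʷ nil        = nil
  reverseʷ (cons e w) = reverseʷ w ++ʷ cons (∼-sym e) nil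

  verts-reverseʷ : ∀ {x y} (w : Walk G x y) → verts G (reverseʷ w) ≡ reverse (verts G w)
  verts-reverseʷ nil = refl
  verts-reverseʷ (cons {x} e w) = begin
    initVerts G (reverseʷ w ++ʷ cons (∼-sym e) nil) ++ x ∷ []  ≡⟨ cong (_++ x ∷ []) (initVerts-++ʷ (reverseʷ w) _) ⟩
    verts G (reverseʷ w) ++ x ∷ []                             ≡⟨ cong (_++ x ∷ []) (verts-reverseʷ w) ⟩
    reverse (verts G w) ++ x ∷ []                              ≡⟨ sym (unfold-reverse x (verts G w)) ⟩
    reverse (x ∷ verts G w)                                    ∎
    where open ≡-Reasoning

  verts≡∷interior++ : ∀ {x y} → x ≢ y → (w : Walk G x y) → verts G w ≡ x ∷ interior G w ++ y ∷ []
  verts≡∷interior++ x≢y nil        = ⊥-elim (x≢y refl)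
  verts≡∷interior++ x≢y (cons _ _) = refl

  interior-reverseʷ : ∀ {x y} → x ≢ y → (w : Walk G x y) →
    interior G (reverseʷ w) ≡ reverse (interior G w)
  interior-reverseʷ {x} {y} x≢y w = ++-cancelʳ (x ∷ []) _ _ (∷-injectiveʳ (begin
    y ∷ interior G (reverseʷ w) ++ x ∷ []    ≡⟨ sym (verts≡∷interior++ (x≢y ∘ sym) (reverseʷ w)) ⟩
    verts G (reverseʷ w)                     ≡⟨ verts-reverseʷ w ⟩
    reverse (verts G w)                      ≡⟨ cong reverse (verts≡∷interior++ x≢y w) ⟩
    reverse (x ∷ interior G w ++ y ∷ [])     ≡⟨ unfold-reverse x (interior G w ++ y ∷ []) ⟩
    reverse (interior G w ++ y ∷ []) ++ x ∷ [] ≡⟨ cong (_++ x ∷ []) (reverse-++ (interior G w) (y ∷ [])) ⟩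
    y ∷ reverse (interior G w) ++ x ∷ []     ∎))
    where open ≡-Reasoning

  reversePath : ∀ {x y} → Path G x y → Path G y x
  reversePath P = record
    { walk   = reverseʷ (walk P)
    ; simple = subst Unique (sym (verts-reverseʷ (walk P)))
                 (Unique-resp-↭ (setoid _) (↭-sym (setoid _) (↭-reverse (setoid _) _)) (simple P))
    }

  HasDisjointPaths-sym : ∀ {x y k} → x ≢ y → HasDisjointPaths G x y k → HasDisjointPaths G y x k
  HasDisjointPaths-sym x≢y (P , disjoint) = reversePath ∘ P , λ i j i≢j →
    (λ v v∈Iᵢ v∈Iⱼ → proj₁ (disjoint i j i≢j) v (∈interior-reverseʷ (P i) v∈Iᵢ) (∈interior-reverseʷ (P j) v∈Iⱼ)) ,
    λ eq → proj₂ (disjoint i j i≢j) (reverse-injective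
      (trans (sym (verts-reverseʷ (walk (P i)))) (trans eq (verts-reverseʷ (walk (P j))))))
    where
    ∈interior-reverseʷ : ∀ {v} (Q : Path G _ _) → v ∈ₗ interior G (reverseʷ (walk Q)) → v ∈ₗ interior G (walk Q)
    ∈interior-reverseʷ Q = reverse⁻ ∘ subst (_ ∈ₗ_) (interior-reverseʷ x≢y (walk Q))

  IsKappa-sym : ∀ {x y k} → x ≢ y → IsKappa G x y k → IsKappa G y x k
  IsKappa-sym x≢y (paths , max) = HasDisjointPaths-sym x≢y paths , λ m → max m ∘ HasDisjointPaths-sym (x≢y ∘ sym)

  tight : ∀ {X x y k} → IsXYSet G x y X → IsKappa G x y k → ∣ ∂ G X ∣ ≡ k → Tight G x y X
  tight xy-set κ ∣∂X∣≡k = xy-set , subst (IsKappa G _ _) (sym ∣∂X∣≡k) κ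

  xySets-tight : ∀ {X Y x y x′ y′ k l} →
    IsXYSet G x y X → IsKappa G x y k → IsXYSet G x′ y′ Y → IsKappa G x′ y′ l →
    ∣ ∂ G X ∣ + ∣ ∂ G Y ∣ ≤ k + l → Tight G x y X × Tight G x′ y′ Y
  xySets-tight X-set κ₁ Y-set κ₂ ∣∂X∣+∣∂Y∣≤k+l
    with ∣∂X∣≡k , ∣∂Y∣≡l ← +-squeeze (IsKappa⇒≤∣∂∣ X-set κ₁) (IsKappa⇒≤∣∂∣ Y-set κ₂) ∣∂X∣+∣∂Y∣≤k+l
    = tight X-set κ₁ ∣∂X∣≡k , tight Y-set κ₂ ∣∂Y∣≡l

  module Uncrossing {s a b : Fin n} {A B : Subset n} {ka kb : ℕ}
    (κa : IsKappa G s a ka) (κb : IsKappa G s b kb) (TA : Tight G s a A) (TB : Tight G s b B) where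

    Ia Ib II III : Set
    Ia  = a ∈ _* G A ∩ _* G B × ka ≡ kb × Tight G s a (A ∩ B) × Tight G s a (A ∪ B) × Tight G s b (A ∩ B)
    Ib  = a ∉ _* G A ∩ _* G B × b ∈ _* G A ∩ _* G B × Tight G s a (A ∩ B) × Tight G s b (A ∪ B)
    II  = a ∈ _* G A ∩ B × b ∈ _* G B ∩ A × Tight G a s (_* G A ∩ B) × Tight G b s (_* G B ∩ A)
    III = (a ∈ ∂ G B × b ∈ _* G B ∩ A) ⊎ (b ∈ ∂ G A × a ∈ _* G A ∩ B) ⊎ (a ∈ ∂ G B × b ∈ ∂ G A)

    s∈A : s ∈ A
    s∈A = proj₁ (proj₁ TA)

    a∈A* : a ∈ _* G A
    a∈A* = proj₂ (proj₁ TA)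

    s∈B : s ∈ B
    s∈B = proj₁ (proj₁ TB)

    b∈B* : b ∈ _* G B
    b∈B* = proj₂ (proj₁ TB)

    ∣∂A∣+∣∂B∣≡ka+kb : ∣ ∂ G A ∣ + ∣ ∂ G B ∣ ≡ ka + kb
    ∣∂A∣+∣∂B∣≡ka+kb = cong₂ _+_ (IsKappa-unique (proj₂ TA) κa) (IsKappa-unique (proj₂ TB) κb)

    submodular : ∣ ∂ G (A ∩ B) ∣ + ∣ ∂ G (A ∪ B) ∣ ≤ ka + kb
    submodular = ≤-trans (∂-submodular A B) (≤-reflexive ∣∂A∣+∣∂B∣≡ka+kb)

    posimodular : ∣ ∂ G (_* G A ∩ B) ∣ + ∣ ∂ G (_* G B ∩ A) ∣ ≤ ka + kb
    posimodular = ≤-trans (∂-posimodular A B) (≤-reflexive ∣∂A∣+∣∂B∣≡ka+kb)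

    s∈A∩B : s ∈ A ∩ B
    s∈A∩B = x∈p∩q⁺ (s∈A , s∈B)

    s∈A∪B : s ∈ A ∪ B
    s∈A∪B = x∈p∪q⁺ (inj₁ s∈A)

    case-Ia : kb ≤ ka → a ∈ _* G B → Ia
    case-Ia kb≤ka a∈B* = a∈A*∩B* , ka≡kb , T∩ , T∪ ,
      tight (s∈A∩B , p⊆q⇒q*⊆p* (p∩q⊆q A B) b∈B*) κb (trans (IsKappa-unique (proj₂ T∩) κa) ka≡kb)
      where
      a∈A*∩B* : a ∈ _* G A ∩ _* G B
      a∈A*∩B* = x∈p∩q⁺ (a∈A* , a∈B*)
      ka≡kb : ka ≡ kb
      ka≡kb = ≤-antisym
        (subst (ka ≤_) (IsKappa-unique (proj₂ TB) κb) (IsKappa⇒≤∣∂∣ (s∈B , a∈B*) κa)) kb≤ka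
      T∩∪ : Tight G s a (A ∩ B) × Tight G s a (A ∪ B)
      T∩∪ = xySets-tight (s∈A∩B , p⊆q⇒q*⊆p* (p∩q⊆p A B) a∈A*) κa
                         (s∈A∪B , p*∩q*⊆[p∪q]* {A} {B} a∈A*∩B*) κa
                         (subst (λ k → _ ≤ ka + k) (sym ka≡kb) submodular)
      T∩ : Tight G s a (A ∩ B)
      T∩ = proj₁ T∩∪
      T∪ : Tight G s a (A ∪ B)
      T∪ = proj₂ T∩∪

    case-Ib : a ∉ _* G B → b ∈ _* G A → Ib
    case-Ib a∉B* b∈A* = a∉B* ∘ p∩q⊆q (_* G A) (_* G B) , b∈A*∩B* ,
      xySets-tight (s∈A∩B , p⊆q⇒q*⊆p* (p∩q⊆p A B) a∈A*) κa
                   (s∈A∪B , p*∩q*⊆[p∪q]* {A} {B} b∈A*∩B*) κb submodular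
      where
      b∈A*∩B* : b ∈ _* G A ∩ _* G B
      b∈A*∩B* = x∈p∩q⁺ (b∈A* , b∈B*)

    case-II : a ≢ s → b ≢ s → a ∈ B → b ∈ A → II
    case-II a≢s b≢s a∈B b∈A = a∈A*∩B , b∈B*∩A ,
      xySets-tight (a∈A*∩B , p⊆[p*∩q]* {A} {B} s∈A) (IsKappa-sym (a≢s ∘ sym) κa)
                   (b∈B*∩A , p⊆[p*∩q]* {B} {A} s∈B) (IsKappa-sym (b≢s ∘ sym) κb) posimodular
      where
      a∈A*∩B : a ∈ _* G A ∩ B
      a∈A*∩B = x∈p∩q⁺ (a∈A* , a∈B)
      b∈B*∩A : b ∈ _* G B ∩ A
      b∈B*∩A = x∈p∩q⁺ (b∈B* , b∈A)

    alternatives : a ≢ s → b ≢ s → kb ≤ ka → Ia ⊎ Ib ⊎ II ⊎ III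
    alternatives a≢s b≢s kb≤ka with ∈⊎∈∂⊎∈* B a | ∈⊎∈∂⊎∈* A b
    ... | inj₂ (inj₂ a∈B*) | _                = inj₁ (case-Ia kb≤ka a∈B*)
    ... | inj₁ a∈B         | inj₁ b∈A         = inj₂ (inj₂ (inj₁ (case-II a≢s b≢s a∈B b∈A)))
    ... | inj₁ a∈B         | inj₂ (inj₁ b∈∂A) = inj₂ (inj₂ (inj₂ (inj₂ (inj₁ (b∈∂A , x∈p∩q⁺ (a∈A* , a∈B))))))
    ... | inj₁ a∈B         | inj₂ (inj₂ b∈A*) = inj₂ (inj₁ (case-Ib (λ a∈B* → ∈*⇒∉ {B} a∈B* a∈B) b∈A*))
    ... | inj₂ (inj₁ a∈∂B) | inj₁ b∈A         = inj₂ (inj₂ (inj₂ (inj₁ (a∈∂B , x∈p∩q⁺ (b∈B* , b∈A)))))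
    ... | inj₂ (inj₁ a∈∂B) | inj₂ (inj₁ b∈∂A) = inj₂ (inj₂ (inj₂ (inj₂ (inj₂ (a∈∂B , b∈∂A)))))
    ... | inj₂ (inj₁ a∈∂B) | inj₂ (inj₂ b∈A*) = inj₂ (inj₁ (case-Ib (∈∂⇒∉* {B} a∈∂B) b∈A*))

    III⇒∂ : III → a ∈ ∂ G B ⊎ b ∈ ∂ G A
    III⇒∂ (inj₁ (a∈∂B , _))        = inj₁ a∈∂B
    III⇒∂ (inj₂ (inj₁ (b∈∂A , _))) = inj₂ b∈∂A
    III⇒∂ (inj₂ (inj₂ (a∈∂B , _))) = inj₁ a∈∂B

    III⇒a∉B* : III → a ∉ _* G B
    III⇒a∉B* (inj₁ (a∈∂B , _))            = ∈∂⇒∉* {B} a∈∂B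
    III⇒a∉B* (inj₂ (inj₁ (_ , a∈A*∩B)))   = λ a∈B* → ∈*⇒∉ {B} a∈B* (p∩q⊆q (_* G A) B a∈A*∩B)
    III⇒a∉B* (inj₂ (inj₂ (a∈∂B , _)))     = ∈∂⇒∉* {B} a∈∂B

    III⇒b∉A* : III → b ∉ _* G A
    III⇒b∉A* (inj₁ (_ , b∈B*∩A))          = λ b∈A* → ∈*⇒∉ {A} b∈A* (p∩q⊆q (_* G B) A b∈B*∩A)
    III⇒b∉A* (inj₂ (inj₁ (b∈∂A , _)))     = ∈∂⇒∉* {A} b∈∂A
    III⇒b∉A* (inj₂ (inj₂ (_ , b∈∂A)))     = ∈∂⇒∉* {A} b∈∂A

    exclusive : ¬ (Ia × Ib) × ¬ (Ia × II) × ¬ (Ia × III) × ¬ (Ib × II) × ¬ (Ib × III) × ¬ (II × III)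
    exclusive =
      (λ (ia , ib) → proj₁ ib (proj₁ ia)) ,
      (λ (ia , ii) → ∈*⇒∉ {B} (a∈B* ia) (p∩q⊆q (_* G A) B (proj₁ ii))) ,
      (λ (ia , iii) → III⇒a∉B* iii (a∈B* ia)) ,
      (λ (ib , ii) → ∈*⇒∉ {A} (b∈A* ib) (p∩q⊆q (_* G B) A (proj₁ (proj₂ ii)))) ,
      (λ (ib , iii) → III⇒b∉A* iii (b∈A* ib)) ,
      (λ (ii , iii) → [ (λ a∈∂B → ∈∂⇒∉ {B} a∈∂B (p∩q⊆q (_* G A) B (proj₁ ii))) ,
                        (λ b∈∂A → ∈∂⇒∉ {A} b∈∂A (p∩q⊆q (_* G B) A (proj₁ (proj₂ ii)))) ] (III⇒∂ iii))
      where
      a∈B* : Ia → a ∈ _* G B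
      a∈B* = p∩q⊆q (_* G A) (_* G B) ∘ proj₁
      b∈A* : Ib → b ∈ _* G A
      b∈A* = p∩q⊆p (_* G A) (_* G B) ∘ proj₁ ∘ proj₂

lemma5 : (n : ℕ) (G : Graph n) (s a b : Fin n) → a ≢ s → b ≢ s →
    (A B : Subset n) (ka kb : ℕ) →
    IsKappa G s a ka → IsKappa G s b kb → kb ≤ ka →
    Tight G s a A → Tight G s b B →
    ExactlyOne4
      (a ∈ _* G A ∩ _* G B × ka ≡ kb × Tight G s a (A ∩ B) × Tight G s a (A ∪ B)
        × Tight G s b (A ∩ B))
      (a ∉ _* G A ∩ _* G B × b ∈ _* G A ∩ _* G B × Tight G s a (A ∩ B)
        × Tight G s b (A ∪ B))
      (a ∈ _* G A ∩ B × b ∈ _* G B ∩ A × Tight G a s (_* G A ∩ B)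
        × Tight G b s (_* G B ∩ A))
      ((a ∈ ∂ G B × b ∈ _* G B ∩ A) ⊎ (b ∈ ∂ G A × a ∈ _* G A ∩ B)
        ⊎ (a ∈ ∂ G B × b ∈ ∂ G A))
lemma5 n G s a b a≢s b≢s A B ka kb κa κb kb≤ka TA TB =
  alternatives a≢s b≢s kb≤ka , exclusive
  where open Uncrossing G κa κb TA TB
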